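{- For a graph $G$ let $\overline{d}(G)=2e(G)/n(G)$ denote its average degree. Then $$\mathrm{m}(G)\leq \left\lfloor \frac{\overline{d}(G)}{2}\right\rfloor+2.$$
   Context: All graphs are finite, simple and undirected, with $n(G)\ge 1$ vertices and $e(G)$ edges. A $k$-list assignment $L$ to $G$ assigns to each vertex $v$ a set $L(v)$ of exactly $k$ colors; an $L$-coloring is a proper coloring $c$ with $c(v)\in L(v)$ for all $v$. $G$ is uniquely $k$-list colorable if some $k$-list assignment $L$ admits exactly one $L$-coloring of $G$. The m-number $\mathrm{m}(G)$ is the minimum positive integer $k$ such that $G$ is not uniquely $k$-list colorable. -}

module Defs where

open import Data.Nat using (ℕ; zero; suc; _+_; _*_; _<ᵇ_; _≤_; _/_; NonZero)
open import Data.Bool using (Bool; true; false; if_then_else_; _∧_)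
open import Data.Fin using (Fin; toℕ)
open import Data.List using (List; map; allFin)
open import Data.Nat.ListAction using (sum)
open import Data.Product using (Σ; ∃; ∃-syntax; _×_; _,_)
open import Function.Definitions using (Injective)
open import Relation.Binary.PropositionalEquality using (_≡_; _≢_)
open import Relation.Nullary using (¬_)

record Graph (n : ℕ) : Set where
  field
    adj     : Fin n → Fin n → Bool
    sym     : ∀ u v → adj u v ≡ adj v u
    irrefl  : ∀ v → adj v v ≡ false

open Graph public

edges : ∀ {n} → Graph n → ℕ
edges {n} G =
  sum (map (λ i → sum (map (λ j → if (toℕ i <ᵇ toℕ j) ∧ adj G i j then 1 else 0)
                             (allFin n)))
           (allFin n))

-- Colors are natural numbers. A k-list assignment gives each vertex v a set
-- L(v) of exactly k colors, represented by an injective enumeration Fin k → ℕ.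
record ListAssignment (n k : ℕ) : Set where
  field
    list  : Fin n → Fin k → ℕ
    exact : ∀ v → Injective _≡_ _≡_ (list v)

open ListAssignment public

_∈L_ : ∀ {n k} → ℕ → (L : ListAssignment n k) → Fin n → Set
(c ∈L L) v = ∃[ i ] list L v i ≡ c

IsLColoring : ∀ {n k} → Graph n → ListAssignment n k → (Fin n → ℕ) → Set
IsLColoring G L c =
  (∀ v → (c v ∈L L) v) × (∀ u v → adj G u v ≡ true → c u ≢ c v)

UniquelyListColorable : ∀ {n} → Graph n → ℕ → Set
UniquelyListColorable {n} G k =
  ∃[ L ] ∃[ c ] (IsLColoring {k = k} G L c ×
                 (∀ c′ → IsLColoring G L c′ → ∀ v → c′ v ≡ c v))

-- m(G) ≤ b  (m(G) = least positive k with G not uniquely k-list colorable):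
-- unfolds to: some k with 1 ≤ k ≤ b makes G not uniquely k-list colorable.
m≤ : ∀ {n} → Graph n → ℕ → Set
m≤ G b = ∃[ k ] (1 ≤ k × k ≤ b × ¬ UniquelyListColorable G k)

{-# OPTIONS --safe #-}
-- Write k = ⌊d̄/2⌋ + 2, so that e(G) < n (k - 1). Suppose a k-list assignment L has a unique
-- L-coloring c, and consider the graph polynomial P(y) = ∏_{uv ∈ E, u < v} (y_u - y_v) on the
-- grid ∏_v L(v). Along each axis take the leading divided difference on L(v), i.e. the
-- coefficient of x^(k-1) in the interpolating polynomial, and tensor these functionals (the
-- coefficient form of the Combinatorial Nullstellensatz). The tensor kills every monomial whose
-- degree in some y_v is below k - 1, hence kills P, as deg P = e(G) < n (k - 1). But P vanishes
-- at every grid point that is not a proper coloring, i.e. everywhere except at c, so the tensor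
-- sends P to a nonzero multiple of P(c) ≠ 0. Everything is computed over ℤ without division,
-- and P is never expanded into monomials: its factors are absorbed one at a time into Newton
-- monomials of the grid, each factor raising the degree in a single variable by one.
module Submission where

open import Data.Bool using (Bool; true; false; T; if_then_else_; _∧_)
open import Data.Bool.Properties using (T-∧; T-≡)
open import Data.Fin using (Fin; zero; suc; toℕ; punchIn)
open import Data.Fin.Properties using (¬∀⟶∃¬; punchIn-injective; punchInᵢ≢i; toℕ-injective)
open import Data.List using (List; []; _∷_; length; map; concatMap; filterᵇ; allFin; tabulate)
open import Data.List.Membership.Propositional using (_∈_; _∉_)
open import Data.List.Membership.Propositional.Properties
  using (∈-concat⁺′; ∈-map⁺; ∈-filter⁺; ∈-allFin; ∈-tabulate⁻)
open import Data.List.Properties using (length-++; length-map; length-tabulate; map-cong)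
open import Data.List.Relation.Unary.All as All using (All; []; _∷_)
open import Data.List.Relation.Unary.All.Properties
  using (All¬⇒¬Any; all-filter; concat⁺; map⁺; tabulate⁺)
open import Data.List.Relation.Unary.Any using (here; there)
open import Data.List.Relation.Unary.Unique.Propositional using (Unique; []; _∷_)
open import Data.List.Relation.Unary.Unique.Propositional.Properties using ()
  renaming (tabulate⁺ to unique-tabulate)
import Data.Nat as ℕ
open import Data.Nat using (ℕ; zero; suc; _<ᵇ_; _≤_; _<_; z≤n; s≤s; _≤?_; NonZero)
open import Data.Nat.DivMod using (_/_; _%_; m≡m%n+[m/n]*n; m%n<n; m/n/o≡m/[n*o]; m*n/m*o≡n/o; /-congʳ)
open import Data.Nat.ListAction using (sum)
open import Data.Nat.Properties
  using (<-cmp; <⇒<ᵇ; ≰⇒>; <⇒≱; <⇒≤; ≤-reflexive; +-suc; +-mono-≤; +-monoˡ-<; +-identityʳ;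
         *-comm; m*n≢0; +-0-monoid; module ≤-Reasoning)
open import Data.Nat.Tactic.RingSolver using () renaming (solve-∀ to ℕ-solve-∀)
open import Data.Product using (∃; _×_; _,_; proj₁; proj₂; map₂)
open import Data.Sum using (_⊎_; inj₁; inj₂; [_,_]′)
open import Data.Vec.Functional using (Vector; head; tail; updateAt) renaming (_∷_ to _∷ᵛ_)
open import Function using (_∘_; Equivalence)
open import Relation.Binary using (tri<; tri≈; tri>)
open import Relation.Binary.PropositionalEquality
  using (_≡_; _≢_; _≗_; refl; sym; trans; cong; cong₂; subst; subst₂; module ≡-Reasoning)
open import Relation.Nullary using (¬_; yes; no; contradiction)
open import Relation.Nullary.Decidable using (T?)

open import Algebra.Properties.Monoid.Sum +-0-monoid using ()
  renaming (sum to ∑; sum-cong-≗ to ∑-cong; sum-replicate-zero to ∑-replicate-0)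
open import Defs hiding (sym)

∑-updateAt-suc : ∀ {N} (d : Vector ℕ N) s → ∑ (updateAt d s suc) ≡ suc (∑ d)
∑-updateAt-suc d zero    = refl
∑-updateAt-suc d (suc s) = trans (cong (head d ℕ.+_) (∑-updateAt-suc (tail d) s)) (+-suc (head d) _)

∑-mono-≤ : ∀ {N} {d e : Vector ℕ N} → (∀ v → d v ≤ e v) → ∑ d ≤ ∑ e
∑-mono-≤ {zero}  d≤e = z≤n
∑-mono-≤ {suc N} d≤e = +-mono-≤ (d≤e zero) (∑-mono-≤ (d≤e ∘ suc))

∑<⇒∃< : ∀ {N} (d e : Vector ℕ N) → ∑ d < ∑ e → ∃ λ v → d v < e v
∑<⇒∃< {N} d e ∑d<∑e =
  map₂ ≰⇒> (¬∀⟶∃¬ N (λ v → e v ≤ d v) (λ v → e v ≤? d v) (λ e≤d → <⇒≱ ∑d<∑e (∑-mono-≤ e≤d)))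

∑-const : ∀ n m → ∑ {n} (λ _ → m) ≡ n ℕ.* m
∑-const zero    m = refl
∑-const (suc n) m = cong (m ℕ.+_) (∑-const n m)

length-concatMap : ∀ {A B : Set} (f : A → List B) xs →
  length (concatMap f xs) ≡ sum (map (length ∘ f) xs)
length-concatMap f []       = refl
length-concatMap f (x ∷ xs) = trans (length-++ (f x)) (cong (length (f x) ℕ.+_) (length-concatMap f xs))

length-filterᵇ : ∀ {A : Set} (p : A → Bool) xs →
  length (filterᵇ p xs) ≡ sum (map (λ x → if p x then 1 else 0) xs)
length-filterᵇ p []       = refl
length-filterᵇ p (x ∷ xs) with p x
... | true  = cong suc (length-filterᵇ p xs)
... | false = length-filterᵇ p xs

module Nullstellensatz where

  open import Data.Integer using (ℤ; _+_; _*_; _-_; -_; 0ℤ; 1ℤ)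
  open import Data.Integer.Properties as ℤ using (_≟_)
  open import Data.Integer.Tactic.RingSolver using (solve-∀)
  open import Algebra.Properties.Monoid.Sum ℤ.*-1-monoid using ()
    renaming (sum to ∏; sum-replicate-zero to ∏-replicate-1)

  *-≢0 : ∀ {i j} → i ≢ 0ℤ → j ≢ 0ℤ → i * j ≢ 0ℤ
  *-≢0 {i} i≢0 j≢0 = [ i≢0 , j≢0 ]′ ∘ ℤ.i*j≡0⇒i≡0∨j≡0 i

  prodDiff : ℤ → List ℤ → ℤ
  prodDiff a []      = 1ℤ
  prodDiff a (y ∷ B) = (y - a) * prodDiff a B

  prodDiffExcept : ℤ → List ℤ → ℤ → ℤ
  prodDiffExcept a []      x = 1ℤ
  prodDiffExcept a (y ∷ B) x with y ≟ x
  ... | yes _ = prodDiff a B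
  ... | no  _ = (y - a) * prodDiffExcept a B x

  prodDiffExcept-head : ∀ a x B → prodDiffExcept a (x ∷ B) x ≡ prodDiff a B
  prodDiffExcept-head a x B with x ≟ x
  ... | yes _  = refl
  ... | no x≢x = contradiction refl x≢x

  prodDiff-split : ∀ a {x} B → x ∈ B → (x - a) * prodDiffExcept a B x ≡ prodDiff a B
  prodDiff-split a {x} (y ∷ B) x∈B with y ≟ x
  ... | yes refl = refl
  prodDiff-split a (y ∷ B) (here refl) | no y≢x = contradiction refl y≢x
  prodDiff-split a {x} (y ∷ B) (there x∈B) | no _ = begin
    (x - a) * ((y - a) * prodDiffExcept a B x)  ≡⟨ swap (x - a) (y - a) _ ⟩
    (y - a) * ((x - a) * prodDiffExcept a B x)  ≡⟨ cong ((y - a) *_) (prodDiff-split a B x∈B) ⟩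
    (y - a) * prodDiff a B                      ∎
    where
    open ≡-Reasoning
    swap : ∀ p q r → p * (q * r) ≡ q * (p * r)
    swap = solve-∀

  prodDiff≢0 : ∀ {a} B → a ∉ B → prodDiff a B ≢ 0ℤ
  prodDiff≢0     []      a∉B ()
  prodDiff≢0 {a} (y ∷ B) a∉B =
    *-≢0 (λ y-a≡0 → a∉B (here (sym (ℤ.i-j≡0⇒i≡j y a y-a≡0)))) (prodDiff≢0 B (a∉B ∘ there))

  vandermonde : List ℤ → ℤ
  vandermonde []       = 1ℤ
  vandermonde (a ∷ ns) = vandermonde ns * prodDiff a ns

  vandermonde≢0 : ∀ {ns} → Unique ns → vandermonde ns ≢ 0ℤ
  vandermonde≢0 []                  = λ ()
  vandermonde≢0 {a ∷ ns} (a≢ns ∷ u) = *-≢0 (vandermonde≢0 u) (prodDiff≢0 ns (All¬⇒¬Any a≢ns))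

  -- Up to a factor that is nonzero for distinct nodes, divDiff b ns f is the leading divided
  -- difference of f on the nodes ns ++ [ b ]. Division is avoided because on the remaining
  -- nodes x ∈ b ∷ ns, (f x - f a) * prodDiffExcept a (b ∷ ns) x = prodDiff a (b ∷ ns) * f[a, x].
  divDiff : ℤ → List ℤ → (ℤ → ℤ) → ℤ
  divDiff b []       f = f b
  divDiff b (a ∷ ns) f = divDiff b ns (λ x → (f x - f a) * prodDiffExcept a (b ∷ ns) x)

  divDiff-cong : ∀ b ns {f g} → (∀ {x} → x ∈ b ∷ ns → f x ≡ g x) → divDiff b ns f ≡ divDiff b ns g
  divDiff-cong b []       f≗g = f≗g (here refl)
  divDiff-cong b (a ∷ ns) f≗g = divDiff-cong b ns λ x∈ →
    cong₂ (λ u w → (u - w) * prodDiffExcept a (b ∷ ns) _) (f≗g (skip x∈)) (f≗g (there (here refl)))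
    where
    skip : ∀ {x} → x ∈ b ∷ ns → x ∈ b ∷ a ∷ ns
    skip (here x≡b)  = here x≡b
    skip (there x∈)  = there (there x∈)

  divDiff-linear : ∀ b ns f g c →
    divDiff b ns (λ x → f x + c * g x) ≡ divDiff b ns f + c * divDiff b ns g
  divDiff-linear b []       f g c = refl
  divDiff-linear b (a ∷ ns) f g c =
    trans (divDiff-cong b ns λ _ → distrib c (f _) (f a) (g _) (g a) _) (divDiff-linear b ns _ _ c)
    where
    distrib : ∀ c fx fa gx ga q →
      ((fx + c * gx) - (fa + c * ga)) * q ≡ (fx - fa) * q + c * ((gx - ga) * q)
    distrib = solve-∀

  divDiff-scale : ∀ b ns c f → divDiff b ns (λ x → c * f x) ≡ c * divDiff b ns f
  divDiff-scale b []       c f = refl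
  divDiff-scale b (a ∷ ns) c f =
    trans (divDiff-cong b ns λ _ → distrib c (f _) (f a) _) (divDiff-scale b ns c _)
    where
    distrib : ∀ c fx fa q → (c * fx - c * fa) * q ≡ c * ((fx - fa) * q)
    distrib = solve-∀

  -- newton ns j x = ∏_{i < j} (x - nodeAt ns i), with nodes past the end of ns taken to be 0
  nodeAt : List ℤ → ℕ → ℤ
  nodeAt []       _       = 0ℤ
  nodeAt (a ∷ ns) zero    = a
  nodeAt (a ∷ ns) (suc j) = nodeAt ns j

  newton : List ℤ → ℕ → ℤ → ℤ
  newton ns       zero    x = 1ℤ
  newton []       (suc j) x = x * newton [] j x
  newton (a ∷ ns) (suc j) x = (x - a) * newton ns j x

  x*newton : ∀ ns j x → x * newton ns j x ≡ newton ns (suc j) x + nodeAt ns j * newton ns j x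
  x*newton []       j       x = sym (ℤ.+-identityʳ _)
  x*newton (a ∷ ns) zero    x = split x a
    where
    split : ∀ x a → x * 1ℤ ≡ (x - a) * 1ℤ + a * 1ℤ
    split = solve-∀
  x*newton (a ∷ ns) (suc j) x = begin
    x * ((x - a) * newton ns j x)
      ≡⟨ swap x (x - a) (newton ns j x) ⟩
    (x - a) * (x * newton ns j x)
      ≡⟨ cong ((x - a) *_) (x*newton ns j x) ⟩
    (x - a) * (newton ns (suc j) x + nodeAt ns j * newton ns j x)
      ≡⟨ distrib (x - a) (newton ns (suc j) x) (nodeAt ns j) (newton ns j x) ⟩
    (x - a) * newton ns (suc j) x + nodeAt ns j * ((x - a) * newton ns j x) ∎
    where
    open ≡-Reasoning
    swap : ∀ p q r → p * (q * r) ≡ q * (p * r)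
    swap = solve-∀
    distrib : ∀ p n c m → p * (n + c * m) ≡ p * n + c * (p * m)
    distrib = solve-∀

  divDiff-newton : ∀ b ns {j} → j < length ns → divDiff b ns (newton ns j) ≡ 0ℤ
  -- newton _ 0 is constant, so its first differences compute to 0ℤ * _
  divDiff-newton b (a ∷ ns) {zero}  _         = divDiff-scale b ns 0ℤ (prodDiffExcept a (b ∷ ns))
  divDiff-newton b (a ∷ ns) {suc j} (s≤s j<n) = begin
    divDiff b ns (λ x → (newton (a ∷ ns) (suc j) x - newton (a ∷ ns) (suc j) a) * Q x)
      ≡⟨ divDiff-cong b ns factor ⟩
    divDiff b ns (λ x → prodDiff a (b ∷ ns) * newton ns j x)
      ≡⟨ divDiff-scale b ns (prodDiff a (b ∷ ns)) (newton ns j) ⟩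
    prodDiff a (b ∷ ns) * divDiff b ns (newton ns j)
      ≡⟨ cong (prodDiff a (b ∷ ns) *_) (divDiff-newton b ns j<n) ⟩
    prodDiff a (b ∷ ns) * 0ℤ
      ≡⟨ ℤ.*-zeroʳ (prodDiff a (b ∷ ns)) ⟩
    0ℤ ∎
    where
    open ≡-Reasoning
    Q : ℤ → ℤ
    Q = prodDiffExcept a (b ∷ ns)
    regroup : ∀ p n n′ q → (p * n - 0ℤ * n′) * q ≡ (p * q) * n
    regroup = solve-∀
    factor : ∀ {x} → x ∈ b ∷ ns →
      ((x - a) * newton ns j x - (a - a) * newton ns j a) * Q x ≡ prodDiff a (b ∷ ns) * newton ns j x
    factor {x} x∈ = begin
      ((x - a) * newton ns j x - (a - a) * newton ns j a) * Q x
        ≡⟨ cong (λ z → ((x - a) * newton ns j x - z * newton ns j a) * Q x) (ℤ.+-inverseʳ a) ⟩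
      ((x - a) * newton ns j x - 0ℤ * newton ns j a) * Q x
        ≡⟨ regroup (x - a) (newton ns j x) (newton ns j a) (Q x) ⟩
      ((x - a) * Q x) * newton ns j x
        ≡⟨ cong (_* newton ns j x) (prodDiff-split a (b ∷ ns) x∈) ⟩
      prodDiff a (b ∷ ns) * newton ns j x ∎

  divDiff-vanishing : ∀ b ns {f} → (∀ {x} → x ∈ ns → f x ≡ 0ℤ) → divDiff b ns f ≡ vandermonde ns * f b
  divDiff-vanishing b []           f0 = sym (ℤ.*-identityˡ _)
  divDiff-vanishing b (a ∷ ns) {f} f0 = begin
    divDiff b ns (λ x → (f x - f a) * prodDiffExcept a (b ∷ ns) x)
      ≡⟨ divDiff-vanishing b ns (λ x∈ → cong₂ (λ u w → (u - w) * _) (f0 (there x∈)) (f0 (here refl))) ⟩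
    vandermonde ns * ((f b - f a) * prodDiffExcept a (b ∷ ns) b)
      ≡⟨ cong₂ (λ u w → vandermonde ns * ((f b - u) * w)) (f0 (here refl)) (prodDiffExcept-head a b ns) ⟩
    vandermonde ns * ((f b - 0ℤ) * prodDiff a ns)
      ≡⟨ regroup (vandermonde ns) (f b) (prodDiff a ns) ⟩
    (vandermonde ns * prodDiff a ns) * f b ∎
    where
    open ≡-Reasoning
    regroup : ∀ w y q → w * ((y - 0ℤ) * q) ≡ (w * q) * y
    regroup = solve-∀

  ∏-zero : ∀ {N} (h : Vector ℤ N) v → h v ≡ 0ℤ → ∏ h ≡ 0ℤ
  ∏-zero h zero    h0 = trans (cong (_* ∏ (tail h)) h0) (ℤ.*-zeroˡ (∏ (tail h)))
  ∏-zero h (suc v) h0 = trans (cong (head h *_) (∏-zero (tail h) v h0)) (ℤ.*-zeroʳ (head h))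

  ∏-≢0 : ∀ {N} (h : Vector ℤ N) → (∀ v → h v ≢ 0ℤ) → ∏ h ≢ 0ℤ
  ∏-≢0 {zero}  h h≢0 = λ ()
  ∏-≢0 {suc N} h h≢0 = *-≢0 (h≢0 zero) (∏-≢0 (tail h) (h≢0 ∘ suc))

  OnGrid : ∀ {N} → Vector ℤ N → Vector (List ℤ) N → Vector ℤ N → Set
  OnGrid b ns y = ∀ v → y v ∈ b v ∷ ns v

  onGrid-∷ : ∀ {N} {b : Vector ℤ (suc N)} {ns x y} →
    x ∈ head b ∷ head ns → OnGrid (tail b) (tail ns) y → OnGrid b ns (x ∷ᵛ y)
  onGrid-∷ x∈ y∈ zero    = x∈
  onGrid-∷ x∈ y∈ (suc v) = y∈ v

  divDiffᴺ : ∀ {N} → Vector ℤ N → Vector (List ℤ) N → (Vector ℤ N → ℤ) → ℤ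
  divDiffᴺ {zero}  b ns F = F b
  divDiffᴺ {suc N} b ns F =
    divDiff (head b) (head ns) (λ x → divDiffᴺ (tail b) (tail ns) (λ y → F (x ∷ᵛ y)))

  divDiffᴺ-cong : ∀ {N} b ns {F G : Vector ℤ N → ℤ} →
    (∀ {y} → OnGrid b ns y → F y ≡ G y) → divDiffᴺ b ns F ≡ divDiffᴺ b ns G
  divDiffᴺ-cong {zero}  b ns F≗G = F≗G (λ ())
  divDiffᴺ-cong {suc N} b ns F≗G = divDiff-cong (head b) (head ns) λ x∈ →
    divDiffᴺ-cong (tail b) (tail ns) λ y∈ → F≗G (onGrid-∷ x∈ y∈)

  divDiffᴺ-linear : ∀ {N} b ns (F G : Vector ℤ N → ℤ) c →
    divDiffᴺ b ns (λ y → F y + c * G y) ≡ divDiffᴺ b ns F + c * divDiffᴺ b ns G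
  divDiffᴺ-linear {zero}  b ns F G c = refl
  divDiffᴺ-linear {suc N} b ns F G c =
    trans (divDiff-cong (head b) (head ns) λ _ → divDiffᴺ-linear (tail b) (tail ns) _ _ c)
          (divDiff-linear (head b) (head ns) _ _ c)

  divDiffᴺ-scale : ∀ {N} b ns c (F : Vector ℤ N → ℤ) →
    divDiffᴺ b ns (λ y → c * F y) ≡ c * divDiffᴺ b ns F
  divDiffᴺ-scale {zero}  b ns c F = refl
  divDiffᴺ-scale {suc N} b ns c F =
    trans (divDiff-cong (head b) (head ns) λ _ → divDiffᴺ-scale (tail b) (tail ns) c _)
          (divDiff-scale (head b) (head ns) c _)

  divDiffᴺ-product : ∀ {N} b ns (g : Vector (ℤ → ℤ) N) →
    divDiffᴺ b ns (λ y → ∏ (λ v → g v (y v))) ≡ ∏ (λ v → divDiff (b v) (ns v) (g v))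
  divDiffᴺ-product {zero}  b ns g = refl
  divDiffᴺ-product {suc N} b ns g = begin
    divDiff (head b) (head ns) (λ x → divDiffᴺ (tail b) (tail ns) (λ y → head g x * G y))
      ≡⟨ divDiff-cong (head b) (head ns) (λ {x} _ → slice x) ⟩
    divDiff (head b) (head ns) (λ x → P * head g x)
      ≡⟨ divDiff-scale (head b) (head ns) P (head g) ⟩
    P * divDiff (head b) (head ns) (head g)
      ≡⟨ ℤ.*-comm P _ ⟩
    divDiff (head b) (head ns) (head g) * P ∎
    where
    open ≡-Reasoning
    G : Vector ℤ N → ℤ
    G y = ∏ (λ v → tail g v (y v))
    P : ℤ
    P = ∏ (λ v → divDiff (tail b v) (tail ns v) (tail g v))
    slice : ∀ x → divDiffᴺ (tail b) (tail ns) (λ y → head g x * G y) ≡ P * head g x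
    slice x = trans (divDiffᴺ-scale (tail b) (tail ns) (head g x) _)
                    (trans (cong (head g x *_) (divDiffᴺ-product (tail b) (tail ns) (tail g)))
                           (ℤ.*-comm (head g x) P))

  divDiffᴺ-pointSupported : ∀ {N} b ns {F : Vector ℤ N → ℤ} {r} → (∀ v → b v ∉ ns v) →
    (∀ {y} → OnGrid b ns y → y ≗ b → F y ≡ r) →
    (∀ {y} → OnGrid b ns y → ¬ y ≗ b → F y ≡ 0ℤ) →
    divDiffᴺ b ns F ≡ ∏ (vandermonde ∘ ns) * r
  divDiffᴺ-pointSupported {zero}  b ns {r = r} b∉ns atB offB = trans (atB (λ ()) (λ ())) (sym (ℤ.*-identityˡ r))
  divDiffᴺ-pointSupported {suc N} b ns {F} {r} b∉ns atB offB = begin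
    divDiff (head b) (head ns) (λ x → divDiffᴺ (tail b) (tail ns) (λ y → F (x ∷ᵛ y)))
      ≡⟨ divDiff-vanishing (head b) (head ns) offSlice ⟩
    vandermonde (head ns) * divDiffᴺ (tail b) (tail ns) (λ y → F (head b ∷ᵛ y))
      ≡⟨ cong (vandermonde (head ns) *_) (divDiffᴺ-pointSupported (tail b) (tail ns) (b∉ns ∘ suc) atB′ offB′) ⟩
    vandermonde (head ns) * (∏ (vandermonde ∘ tail ns) * r)
      ≡⟨ sym (ℤ.*-assoc (vandermonde (head ns)) _ r) ⟩
    ∏ (vandermonde ∘ ns) * r ∎
    where
    open ≡-Reasoning
    offSlice : ∀ {x} → x ∈ head ns → divDiffᴺ (tail b) (tail ns) (λ y → F (x ∷ᵛ y)) ≡ 0ℤ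
    offSlice {x} x∈ =
      trans (divDiffᴺ-pointSupported (tail b) (tail ns) (b∉ns ∘ suc) (λ y∈ _ → off y∈) (λ y∈ _ → off y∈))
            (ℤ.*-zeroʳ (∏ (vandermonde ∘ tail ns)))
      where
      off : ∀ {y} → OnGrid (tail b) (tail ns) y → F (x ∷ᵛ y) ≡ 0ℤ
      off y∈ = offB (onGrid-∷ (there x∈) y∈) (λ x∷y≗b → b∉ns zero (subst (_∈ head ns) (x∷y≗b zero) x∈))
    atB′ : ∀ {y} → OnGrid (tail b) (tail ns) y → y ≗ tail b → F (head b ∷ᵛ y) ≡ r
    atB′ {y} y∈ y≗b = atB (onGrid-∷ (here refl) y∈) λ { zero → refl ; (suc v) → y≗b v }
    offB′ : ∀ {y} → OnGrid (tail b) (tail ns) y → ¬ y ≗ tail b → F (head b ∷ᵛ y) ≡ 0ℤ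
    offB′ y∈ y≉b = offB (onGrid-∷ (here refl) y∈) (λ b∷y≗b → y≉b (b∷y≗b ∘ suc))

  newtonMonomial : ∀ {N} → Vector (List ℤ) N → Vector ℕ N → Vector ℤ N → ℤ
  newtonMonomial ns d y = ∏ (λ v → newton (ns v) (d v) (y v))

  y*newtonMonomial : ∀ {N} ns d (y : Vector ℤ N) s →
    y s * newtonMonomial ns d y ≡
      newtonMonomial ns (updateAt d s suc) y + nodeAt (ns s) (d s) * newtonMonomial ns d y
  y*newtonMonomial ns d y zero = begin
    y zero * (n * R)      ≡⟨ ℤ.*-assoc (y zero) n R ⟨
    (y zero * n) * R      ≡⟨ cong (_* R) (x*newton (head ns) (head d) (y zero)) ⟩
    (n′ + c * n) * R      ≡⟨ distrib n′ c n R ⟩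
    n′ * R + c * (n * R)  ∎
    where
    open ≡-Reasoning
    n n′ R c : ℤ
    n = newton (head ns) (head d) (y zero)
    n′ = newton (head ns) (suc (head d)) (y zero)
    R = newtonMonomial (tail ns) (tail d) (tail y)
    c = nodeAt (head ns) (head d)
    distrib : ∀ n′ c n r → (n′ + c * n) * r ≡ n′ * r + c * (n * r)
    distrib = solve-∀
  y*newtonMonomial ns d y (suc s) = begin
    y (suc s) * (n * R)   ≡⟨ swap (y (suc s)) n R ⟩
    n * (y (suc s) * R)   ≡⟨ cong (n *_) (y*newtonMonomial (tail ns) (tail d) (tail y) s) ⟩
    n * (R′ + c * R)      ≡⟨ distrib n R′ c R ⟩
    n * R′ + c * (n * R)  ∎
    where
    open ≡-Reasoning
    n R R′ c : ℤ
    R′ = newtonMonomial (tail ns) (updateAt (tail d) s suc) (tail y)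
    n = newton (head ns) (head d) (y zero)
    R = newtonMonomial (tail ns) (tail d) (tail y)
    c = nodeAt (ns (suc s)) (d (suc s))
    swap : ∀ p q r → p * (q * r) ≡ q * (p * r)
    swap = solve-∀
    distrib : ∀ n r′ c r → n * (r′ + c * r) ≡ n * r′ + c * (n * r)
    distrib = solve-∀

  edge*newtonMonomial : ∀ {N} ns d (y : Vector ℤ N) s t p →
    ((y s - y t) * p) * newtonMonomial ns d y ≡
      (p * newtonMonomial ns (updateAt d s suc) y + (- 1ℤ) * (p * newtonMonomial ns (updateAt d t suc) y))
        + (nodeAt (ns s) (d s) - nodeAt (ns t) (d t)) * (p * newtonMonomial ns d y)
  edge*newtonMonomial ns d y s t p = begin
    ((y s - y t) * p) * M             ≡⟨ distrib (y s) (y t) p M ⟩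
    p * (y s * M) - p * (y t * M)     ≡⟨ cong₂ (λ u w → p * u - p * w) (y*newtonMonomial ns d y s)
                                                                         (y*newtonMonomial ns d y t) ⟩
    p * (Mₛ + a * M) - p * (Mₜ + b * M) ≡⟨ collect p Mₛ Mₜ a b M ⟩
    (p * Mₛ + (- 1ℤ) * (p * Mₜ)) + (a - b) * (p * M) ∎
    where
    open ≡-Reasoning
    M Mₛ Mₜ a b : ℤ
    M  = newtonMonomial ns d y
    Mₛ = newtonMonomial ns (updateAt d s suc) y
    Mₜ = newtonMonomial ns (updateAt d t suc) y
    a  = nodeAt (ns s) (d s)
    b  = nodeAt (ns t) (d t)
    distrib : ∀ ys yt p m → ((ys - yt) * p) * m ≡ p * (ys * m) - p * (yt * m)
    distrib = solve-∀
    collect : ∀ p mₛ mₜ a b m →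
      p * (mₛ + a * m) - p * (mₜ + b * m) ≡ (p * mₛ + (- 1ℤ) * (p * mₜ)) + (a - b) * (p * m)
    collect = solve-∀

  divDiffᴺ-newtonMonomial : ∀ {N} b ns (d : Vector ℕ N) v → d v < length (ns v) →
    divDiffᴺ b ns (newtonMonomial ns d) ≡ 0ℤ
  divDiffᴺ-newtonMonomial b ns d v dᵥ<len =
    trans (divDiffᴺ-product b ns (λ v → newton (ns v) (d v)))
          (∏-zero _ v (divDiff-newton (b v) (ns v) dᵥ<len))

  edgeProduct : ∀ {N} → List (Fin N × Fin N) → Vector ℤ N → ℤ
  edgeProduct []             y = 1ℤ
  edgeProduct ((s , t) ∷ Es) y = (y s - y t) * edgeProduct Es y

  edgeProduct-cong : ∀ {N} Es {y z : Vector ℤ N} → y ≗ z → edgeProduct Es y ≡ edgeProduct Es z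
  edgeProduct-cong []             y≗z = refl
  edgeProduct-cong ((s , t) ∷ Es) y≗z =
    cong₂ _*_ (cong₂ _-_ (y≗z s) (y≗z t)) (edgeProduct-cong Es y≗z)

  edgeProduct-≡0 : ∀ {N} {Es} {y : Vector ℤ N} {s t} → (s , t) ∈ Es → y s ≡ y t → edgeProduct Es y ≡ 0ℤ
  edgeProduct-≡0 {Es = (s , t) ∷ Es} {y} (here refl) yₛ≡yₜ =
    trans (cong (_* edgeProduct Es y) (ℤ.i≡j⇒i-j≡0 yₛ≡yₜ)) (ℤ.*-zeroˡ (edgeProduct Es y))
  edgeProduct-≡0 {Es = (s′ , t′) ∷ Es} {y} (there st∈Es) yₛ≡yₜ =
    trans (cong ((y s′ - y t′) *_) (edgeProduct-≡0 st∈Es yₛ≡yₜ)) (ℤ.*-zeroʳ (y s′ - y t′))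

  edgeProduct-≢0 : ∀ {N} {Es} {y : Vector ℤ N} →
    All (λ e → y (proj₁ e) ≢ y (proj₂ e)) Es → edgeProduct Es y ≢ 0ℤ
  edgeProduct-≢0 []                             = λ ()
  edgeProduct-≢0 {Es = (s , t) ∷ Es} {y} (yₛ≢yₜ ∷ ≢s) =
    *-≢0 (yₛ≢yₜ ∘ ℤ.i-j≡0⇒i≡j (y s) (y t)) (edgeProduct-≢0 ≢s)

  divDiffᴺ-lowDegree : ∀ {N} b ns Es (d : Vector ℕ N) → length Es ℕ.+ ∑ d < ∑ (length ∘ ns) →
    divDiffᴺ b ns (λ y → edgeProduct Es y * newtonMonomial ns d y) ≡ 0ℤ
  divDiffᴺ-lowDegree b ns [] d deg< with ∑<⇒∃< d (length ∘ ns) deg<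
  ... | v , dᵥ<len =
    trans (divDiffᴺ-cong b ns (λ _ → ℤ.*-identityˡ _)) (divDiffᴺ-newtonMonomial b ns d v dᵥ<len)
  divDiffᴺ-lowDegree {N} b ns ((s , t) ∷ Es) d deg< = begin
    divDiffᴺ b ns (λ y → ((y s - y t) * P y) * M d y)
      ≡⟨ divDiffᴺ-cong b ns (λ {y} _ → edge*newtonMonomial ns d y s t (P y)) ⟩
    divDiffᴺ b ns (λ y → (P y * M dₛ y + (- 1ℤ) * (P y * M dₜ y)) + c * (P y * M d y))
      ≡⟨ divDiffᴺ-linear b ns _ _ c ⟩
    divDiffᴺ b ns (λ y → P y * M dₛ y + (- 1ℤ) * (P y * M dₜ y)) + c * D d
      ≡⟨ cong (_+ c * D d) (divDiffᴺ-linear b ns _ _ (- 1ℤ)) ⟩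
    (D dₛ + (- 1ℤ) * D dₜ) + c * D d
      ≡⟨ cong₂ (λ u w → (u + (- 1ℤ) * w) + c * D d) (lower s) (lower t) ⟩
    0ℤ + c * D d
      ≡⟨ ℤ.+-identityˡ (c * D d) ⟩
    c * D d
      ≡⟨ cong (c *_) (divDiffᴺ-lowDegree b ns Es d (<⇒≤ deg<)) ⟩
    c * 0ℤ
      ≡⟨ ℤ.*-zeroʳ c ⟩
    0ℤ ∎
    where
    open ≡-Reasoning
    P : Vector ℤ N → ℤ
    P = edgeProduct Es
    M : Vector ℕ N → Vector ℤ N → ℤ
    M = newtonMonomial ns
    D : Vector ℕ N → ℤ
    D d′ = divDiffᴺ b ns (λ y → P y * M d′ y)
    dₛ dₜ : Vector ℕ N
    dₛ = updateAt d s suc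
    dₜ = updateAt d t suc
    c : ℤ
    c = nodeAt (ns s) (d s) - nodeAt (ns t) (d t)
    lower : ∀ u → D (updateAt d u suc) ≡ 0ℤ
    lower u = divDiffᴺ-lowDegree b ns Es (updateAt d u suc)
      (subst (_< ∑ (length ∘ ns)) (sym degree-shift) deg<)
      where
      degree-shift : length Es ℕ.+ ∑ (updateAt d u suc) ≡ suc (length Es ℕ.+ ∑ d)
      degree-shift = trans (cong (length Es ℕ.+_) (∑-updateAt-suc d u)) (+-suc (length Es) (∑ d))

module GraphPolynomial where

  open Nullstellensatz
  open import Data.Integer using (ℤ; +_; _*_; 0ℤ)
  open import Data.Integer.Properties as ℤ using (_≟_)
  open import Algebra.Properties.Monoid.Sum ℤ.*-1-monoid using ()
    renaming (sum to ∏; sum-replicate-zero to ∏-replicate-1)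

  orderedEdge : ∀ {n} → Graph n → Fin n → Fin n → Bool
  orderedEdge G i j = (toℕ i <ᵇ toℕ j) ∧ adj G i j

  edgeList : ∀ {n} → Graph n → List (Fin n × Fin n)
  edgeList {n} G = concatMap (λ i → map (i ,_) (filterᵇ (orderedEdge G i) (allFin n))) (allFin n)

  length-edgeList : ∀ {n} (G : Graph n) → length (edgeList G) ≡ edges G
  length-edgeList {n} G = trans (length-concatMap _ (allFin n)) (cong sum (map-cong row (allFin n)))
    where
    row : ∀ i → length (map (i ,_) (filterᵇ (orderedEdge G i) (allFin n)))
              ≡ sum (map (λ j → if orderedEdge G i j then 1 else 0) (allFin n))
    row i = trans (length-map (i ,_) (filterᵇ (orderedEdge G i) (allFin n)))
                  (length-filterᵇ (orderedEdge G i) (allFin n))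

  edgeList-adj : ∀ {n} (G : Graph n) → All (λ e → adj G (proj₁ e) (proj₂ e) ≡ true) (edgeList G)
  edgeList-adj {n} G = concat⁺ (map⁺ (tabulate⁺ λ i →
    map⁺ (All.map (λ ordered → Equivalence.to T-≡ (proj₂ (Equivalence.to T-∧ ordered)))
                  (all-filter (T? ∘ orderedEdge G i) (allFin n)))))

  orderedEdge⇒∈edgeList : ∀ {n} (G : Graph n) {i j} → toℕ i < toℕ j → adj G i j ≡ true →
    (i , j) ∈ edgeList G
  orderedEdge⇒∈edgeList {n} G {i} {j} i<j ij = ∈-concat⁺′
    (∈-map⁺ (i ,_) (∈-filter⁺ (T? ∘ orderedEdge G i) (∈-allFin j) ordered)) (∈-map⁺ _ (∈-allFin i))
    where
    ordered : T (orderedEdge G i j)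
    ordered = Equivalence.from T-∧ (<⇒<ᵇ i<j , Equivalence.from T-≡ ij)

  adj⇒∈edgeList : ∀ {n} (G : Graph n) {u w} → adj G u w ≡ true →
    (u , w) ∈ edgeList G ⊎ (w , u) ∈ edgeList G
  adj⇒∈edgeList G {u} {w} uw with <-cmp (toℕ u) (toℕ w)
  ... | tri< u<w _ _ = inj₁ (orderedEdge⇒∈edgeList G u<w uw)
  ... | tri> _ _ w<u = inj₂ (orderedEdge⇒∈edgeList G w<u (trans (Graph.sym G w u) uw))
  ... | tri≈ _ u≡w _ with toℕ-injective u≡w
  ...   | refl = contradiction (trans (sym uw) (irrefl G u)) λ ()

  graphPolynomial : ∀ {n} → Graph n → Vector ℤ n → ℤ
  graphPolynomial G = edgeProduct (edgeList G)

  proper⇒graphPolynomial≢0 : ∀ {n} (G : Graph n) {y : Vector ℤ n} →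
    (∀ u w → adj G u w ≡ true → y u ≢ y w) → graphPolynomial G y ≢ 0ℤ
  proper⇒graphPolynomial≢0 G proper =
    edgeProduct-≢0 (All.map (λ {e} → proper (proj₁ e) (proj₂ e)) (edgeList-adj G))

  graphPolynomial≢0⇒proper : ∀ {n} (G : Graph n) {y : Vector ℤ n} →
    graphPolynomial G y ≢ 0ℤ → ∀ u w → adj G u w ≡ true → y u ≢ y w
  graphPolynomial≢0⇒proper G P≢0 u w uw yu≡yw with adj⇒∈edgeList G uw
  ... | inj₁ uw∈ = P≢0 (edgeProduct-≡0 uw∈ yu≡yw)
  ... | inj₂ wu∈ = P≢0 (edgeProduct-≡0 wu∈ (sym yu≡yw))

  -- The grid whose v-th axis is L(v), listed with the color c v as base point.
  module ColoringGrid {n k} (L : ListAssignment n (suc k)) {c : Fin n → ℕ}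
                      (c∈L : ∀ v → (c v ∈L L) v) where

    otherColors : Vector (List ℤ) n
    otherColors v = tabulate (λ j → + list L v (punchIn (proj₁ (c∈L v)) j))

    length-otherColors : ∀ v → length (otherColors v) ≡ k
    length-otherColors v = length-tabulate _

    otherColors-unique : ∀ v → Unique (otherColors v)
    otherColors-unique v =
      unique-tabulate (λ eq → punchIn-injective (proj₁ (c∈L v)) _ _ (exact L v (ℤ.+-injective eq)))

    color∉otherColors : ∀ v → + c v ∉ otherColors v
    color∉otherColors v c∈ with ∈-tabulate⁻ c∈
    ... | j , eq =
      punchInᵢ≢i (proj₁ (c∈L v)) j (sym (exact L v (trans (proj₂ (c∈L v)) (ℤ.+-injective eq))))

    gridPoint⇒listed : ∀ {y} → OnGrid (+_ ∘ c) otherColors y → ∀ v → ∃ λ i → y v ≡ + list L v i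
    gridPoint⇒listed y∈ v with y∈ v
    ... | here y≡c = proj₁ (c∈L v) , trans y≡c (cong +_ (sym (proj₂ (c∈L v))))
    ... | there y∈others with ∈-tabulate⁻ y∈others
    ...   | j , eq = punchIn (proj₁ (c∈L v)) j , eq

    nonzeroGridPoint⇒LColoring : ∀ (G : Graph n) {y} → OnGrid (+_ ∘ c) otherColors y →
      graphPolynomial G y ≢ 0ℤ → ∃ λ c′ → IsLColoring G L c′ × y ≗ +_ ∘ c′
    nonzeroGridPoint⇒LColoring G {y} y∈ P≢0 =
      c′ , ((λ v → proj₁ (listed v) , refl) , proper) , proj₂ ∘ listed
      where
      listed : ∀ v → ∃ λ i → y v ≡ + list L v i
      listed = gridPoint⇒listed y∈
      c′ : Fin n → ℕ
      c′ v = list L v (proj₁ (listed v))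
      proper : ∀ u w → adj G u w ≡ true → c′ u ≢ c′ w
      proper u w uw c′u≡c′w = graphPolynomial≢0⇒proper G P≢0 u w uw
        (trans (proj₂ (listed u)) (trans (cong +_ c′u≡c′w) (sym (proj₂ (listed w)))))

  edges<⇒¬UniquelyListColorable : ∀ {n m} (G : Graph n) → edges G < n ℕ.* m →
    ¬ UniquelyListColorable G (suc m)
  edges<⇒¬UniquelyListColorable {n} {m} G e<nm (L , c , (c∈L , c-proper) , unique) =
    *-≢0 weight≢0 (proper⇒graphPolynomial≢0 G (λ u w uw → c-proper u w uw ∘ ℤ.+-injective))
         (trans (sym concentrated) annihilated)
    where
    open ColoringGrid L c∈L
    b : Vector ℤ n
    b = +_ ∘ c
    weight≢0 : ∏ (vandermonde ∘ otherColors) ≢ 0ℤ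
    weight≢0 = ∏-≢0 _ (vandermonde≢0 ∘ otherColors-unique)
    degree< : length (edgeList G) ℕ.+ ∑ {n} (λ _ → 0) < ∑ (length ∘ otherColors)
    degree< = subst₂ _<_
      (sym (trans (cong₂ ℕ._+_ (length-edgeList G) (∑-replicate-0 n)) (+-identityʳ (edges G))))
      (sym (trans (∑-cong length-otherColors) (∑-const n m))) e<nm
    annihilated : divDiffᴺ b otherColors (graphPolynomial G) ≡ 0ℤ
    annihilated = trans
      (divDiffᴺ-cong b otherColors λ {y} _ →
        sym (trans (cong (graphPolynomial G y *_) (∏-replicate-1 n)) (ℤ.*-identityʳ _)))
      (divDiffᴺ-lowDegree b otherColors (edgeList G) (λ _ → 0) degree<)
    off : ∀ {y} → OnGrid b otherColors y → ¬ y ≗ b → graphPolynomial G y ≡ 0ℤ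
    off {y} y∈ y≉b with graphPolynomial G y ≟ 0ℤ
    ... | yes P≡0 = P≡0
    ... | no  P≢0 with nonzeroGridPoint⇒LColoring G y∈ P≢0
    ...   | c′ , c′-coloring , y≗c′ =
      contradiction (λ v → trans (y≗c′ v) (cong +_ (unique c′ c′-coloring v))) y≉b
    concentrated : divDiffᴺ b otherColors (graphPolynomial G)
                 ≡ ∏ (vandermonde ∘ otherColors) * graphPolynomial G b
    concentrated =
      divDiffᴺ-pointSupported b otherColors color∉otherColors (λ _ → edgeProduct-cong (edgeList G)) off

open GraphPolynomial using (edges<⇒¬UniquelyListColorable)
open import Data.Nat using (_+_; _*_)

m<n*[m/n+1] : ∀ m n .{{_ : NonZero n}} → m < n * (m / n + 1)
m<n*[m/n+1] m n = begin-strict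
  m                  ≡⟨ m≡m%n+[m/n]*n m n ⟩
  m % n + m / n * n  <⟨ +-monoˡ-< (m / n * n) (m%n<n m n) ⟩
  n + m / n * n      ≡⟨ regroup n (m / n) ⟩
  n * (m / n + 1)    ∎
  where
  open ≤-Reasoning
  regroup : ∀ n q → n + q * n ≡ n * (q + 1)
  regroup = ℕ-solve-∀

[2m/n]/2≡m/n : ∀ m n .{{_ : NonZero n}} → 2 * m / n / 2 ≡ m / n
[2m/n]/2≡m/n m n = begin
  2 * m / n / 2    ≡⟨ m/n/o≡m/[n*o] (2 * m) n 2 ⟩
  2 * m / (n * 2)  ≡⟨ /-congʳ (*-comm n 2) ⟩
  2 * m / (2 * n)  ≡⟨ m*n/m*o≡n/o 2 m n ⟩
  m / n            ∎
  where
  open ≡-Reasoning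
  instance
    n*2≢0 : NonZero (n * 2)
    n*2≢0 = m*n≢0 n 2
    2*n≢0 : NonZero (2 * n)
    2*n≢0 = m*n≢0 2 n

theorem6 : (n : ℕ) (G : Graph (suc n)) →
    m≤ G (((2 * edges G) / suc n) / 2 + 2)
theorem6 n G =
  suc (r + 1) , s≤s z≤n , ≤-reflexive (sym (+-suc r 1)) , edges<⇒¬UniquelyListColorable G edges<
  where
  r : ℕ
  r = ((2 * edges G) / suc n) / 2
  edges< : edges G < suc n * (r + 1)
  edges< = subst (λ q → edges G < suc n * (q + 1)) (sym ([2m/n]/2≡m/n (edges G) (suc n)))
                 (m<n*[m/n+1] (edges G) (suc n))
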